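{- Let $k,s,p$ be positive integers with $s\geq 1$, $k,p\geq 2$, and let $\epsilon>0$. For families $\mathcal{H}=\mathcal{H}_n\subseteq\binom{[n]}{k}$ with $\nu(\mathcal{H})\leq s$, if $\nu(\mathcal{K}_{sk+1}(\mathcal{H}))\leq s$ and $$|\mathcal{K}_{sk+1}(\mathcal{H})|\geq\left(\frac{s-1}{(k-2)!}+\epsilon\right)n^{k-2}+o(n^{k-2})$$ as $n\to\infty$, then (for $n$ sufficiently large) $\mathcal{H}$ is the union of $s$ different trivial intersecting families.
   Context: $\nu(\mathcal{G})$ is the largest number of pairwise disjoint members of $\mathcal{G}$. For $E\subseteq[n]$, $d_{\mathcal{H}}(E)=|\{F\in\mathcal{H}:E\subseteq F\}|$, and $\mathcal{K}_d(\mathcal{H})=\{K\in\binom{[n]}{k-1}: d_{\mathcal{H}}(K)\geq d\}$. A family is trivial intersecting if the intersection of all its members is nonempty. "$\mathcal{H}$ is the union of $s$ different trivial intersecting families" means $\mathcal{H}=\bigcup_{i=1}^s\mathcal{G}_i$ where each $\mathcal{G}_i$ is a trivial intersecting family with common element $x_i$, the $x_i$ being distinct. Asymptotics are with $k,s,p,\epsilon$ fixed and $n\to\infty$.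
   Formalization: The parameter ε ranges over the positive rationals, and the $o(n^{k-2})$ term in the lower bound for $|\mathcal{K}_{sk+1}(\mathcal{H})|$ takes rational values. -}

module Defs where

open import Data.Bool using (Bool; true; false; _∧_)
open import Data.Nat as ℕ using (ℕ; zero; suc; _∸_; _!; _≡ᵇ_; _≤ᵇ_)
open import Data.Nat.Properties using (_!≢0)
open import Data.Integer using (+_)
open import Data.Fin using (Fin)
open import Data.Fin.Subset using (Subset; inside; outside; _∈_; _∩_; ∣_∣; Empty)
open import Data.Fin.Subset.Properties using (_⊆?_)
open import Data.List using (List; []; _∷_; _++_; map; filterᵇ; length)
open import Data.Vec using (Vec; []; _∷_)
open import Data.Product using (Σ; ∃; _×_; _,_)
open import Relation.Nullary using (¬_)
open import Relation.Nullary.Decidable using (isYes)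
open import Relation.Binary.PropositionalEquality using (_≡_; _≢_)
open import Data.Rational as ℚ using (ℚ; _/_)

-- All subsets of [n] = Fin n (each exactly once).
allSubsets : (n : ℕ) → List (Subset n)
allSubsets zero = [] ∷ []
allSubsets (suc n) = map (inside ∷_) (allSubsets n) ++ map (outside ∷_) (allSubsets n)

Family : ℕ → Set
Family n = Subset n → Bool

_∈F_ : ∀ {n} → Subset n → Family n → Set
A ∈F G = G A ≡ true

card : ∀ {n} → Family n → ℕ
card {n} G = length (filterᵇ G (allSubsets n))

Uniform : ∀ {n} → ℕ → Family n → Set
Uniform k G = ∀ F → F ∈F G → ∣ F ∣ ≡ k

deg : ∀ {n} → Family n → Subset n → ℕ
deg {n} H E = length (filterᵇ (λ F → H F ∧ isYes (E ⊆? F)) (allSubsets n))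

KFam : ∀ {n} → (k d : ℕ) → Family n → Family n
KFam k d H K = (∣ K ∣ ≡ᵇ (k ∸ 1)) ∧ (d ≤ᵇ deg H K)

IsMatching : ∀ {n} → Family n → (m : ℕ) → (Fin m → Subset n) → Set
IsMatching G m M = (∀ i → M i ∈F G) × (∀ i j → i ≢ j → Empty (M i ∩ M j))

ν≤ : ∀ {n} → Family n → ℕ → Set
ν≤ {n} G s = ∀ m (M : Fin m → Subset n) → IsMatching G m M → m ℕ.≤ s

-- G is a trivial intersecting family whose members all contain x
-- (G nonempty, so that its intersection is a well-defined nonempty set containing x)
TrivialIntersectingAt : ∀ {n} → Family n → Fin n → Set
TrivialIntersectingAt G x = (∃ λ F → F ∈F G) × (∀ F → F ∈F G → x ∈ F)

UnionOfTrivial : ∀ {n} → ℕ → Family n → Set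
UnionOfTrivial {n} s H =
  Σ (Fin s → Fin n) λ x → Σ (Fin s → Family n) λ G →
    (∀ i j → x i ≡ x j → i ≡ j) ×
    (∀ i → TrivialIntersectingAt (G i) (x i)) ×
    (∀ F → (F ∈F H → ∃ λ i → F ∈F G i) × ((∃ λ i → F ∈F G i) → F ∈F H))

ℕ→ℚ : ℕ → ℚ
ℕ→ℚ m = + m / 1

IsLittleO : ℕ → (ℕ → ℚ) → Set
IsLittleO e g = ∀ δ → ℚ.Positive δ → ∃ λ N → ∀ n → N ℕ.≤ n →
  ℚ.∣ g n ∣ ℚ.≤ δ ℚ.* ℕ→ℚ (n ℕ.^ e)

const : ℕ → ℕ → ℚ
const s k = _/_ (+ (s ∸ 1)) ((k ∸ 2) !) {{(k ∸ 2) !≢0}}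

{-# OPTIONS --safe #-}
module Submission where

-- A vertex x is heavy when its degree in K = K_{sk+1}(H) exceeds (sk+1) n^{k-3}.  At most
-- n^{k-3} members of K contain two given vertices, and at most one member of H contains a
-- given K-set and one further vertex, so for a heavy x and any sk other vertices some member
-- of K, and then of H, contains x and avoids them all.  Choosing such sets greedily, s+1
-- heavy vertices would give s+1 disjoint members of K; and if there are exactly s heavy
-- vertices, a member of H missing all of them would extend to s+1 disjoint members of H, so
-- H is the union of the s stars at the heavy vertices.  With at most s-1 heavy vertices, the
-- members of K through a heavy vertex number at most (s-1) n^{k-2}/(k-2)!, while all other
-- members of K meet the at most (k-1)s light vertices of a maximal matching among them and
-- so number O(n^{k-3}); for large n this contradicts the lower bound on |K|.

open import Defs
open import Data.Bool as Bool using (Bool; true; false; _∧_; not)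
open import Data.Bool.Properties using (∧-conicalˡ; ∧-conicalʳ; ∧-zeroʳ; T-≡; not-injective)
open import Data.Fin as Fin using (Fin; zero; suc)
open import Data.Fin.Subset using (Subset; inside; outside; _∈_; _∉_; _⊆_; _∩_; _∪_; ⁅_⁆; ∣_∣; Empty)
open import Data.Fin.Subset.Properties
  using (_⊆?_; _∈?_; p⊆q⇒∣p∣≤∣q∣; ∪-identityʳ; ∣⁅x⁆∣≡1; x≢y⇒x∉⁅y⁆; x∈p∩q⁻; x∈p∪q⁻; x∈⁅x⁆; x∈⁅y⁆⇒x≡y; ∩-comm)
open import Data.Integer as ℤ using (+_; +[1+_]; +≤+)
import Data.Integer.Properties as ℤ
open import Data.List using (List; []; _∷_; _++_; map; length; filter; filterᵇ; take; allFin; concatMap; lookup)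
open import Data.List.Properties using (length-++; length-map; length-take; filter-++)
open import Data.List.Membership.Propositional using (lose) renaming (_∈_ to _∈ₗ_)
open import Data.List.Membership.Propositional.Properties
  using (∈-map⁺; ∈-map⁻; ∈-++⁺ˡ; ∈-++⁺ʳ; ∈-lookup; ∈-filter⁺; ∈-allFin)
open import Data.List.Relation.Unary.All as All using (All; []; _∷_)
import Data.List.Relation.Unary.All.Properties as All
open import Data.List.Relation.Unary.AllPairs using (AllPairs; []; _∷_)
import Data.List.Relation.Unary.AllPairs.Properties as AllPairs
open import Data.List.Relation.Unary.Any as Any using (Any; here; there; any?)
open import Data.List.Relation.Unary.Any.Properties using (lookup-index)
open import Data.List.Relation.Unary.Unique.Propositional.Properties using (allFin⁺)
open import Data.Nat
  using (ℕ; zero; suc; _+_; _*_; _∸_; _^_; _!; _⊔_; _≤_; _<_; _≰_; _≤?_; _<?_; z≤n; s≤s; z<s; _≡ᵇ_; NonZero)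
open import Data.Nat.Properties
open import Data.Nat.Coprimality using (1-coprimeTo) renaming (sym to coprime-sym)
open import Data.Nat.Tactic.RingSolver using (solve-∀)
open import Data.Product using (∃; _×_; _,_; proj₁; proj₂)
open import Data.Rational as ℚ using (ℚ; mkℚ; _/_; ½; 1ℚ; Positive; NonNegative)
import Data.Rational.Properties as ℚ
open import Data.Rational.Unnormalised as ℚᵘ using (mkℚᵘ; *≡*; *≤*)
import Data.Rational.Unnormalised.Properties as ℚᵘ
open import Data.Rational.Solver using (module +-*-Solver)
open import Data.Sum using (_⊎_; inj₁; inj₂; [_,_])
import Data.Sum as Sum
open import Data.Vec using ([]; _∷_; here; there)
open import Function using (_∘_; case_of_; Equivalence)
open import Relation.Binary.Definitions using (Symmetric)
open import Relation.Binary.PropositionalEquality hiding ([_])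
open import Relation.Nullary using (Dec; yes; no; contradiction; ¬?; _×-dec_)
open import Relation.Nullary.Decidable using (isYes; isYes≗does; toWitness; fromWitness)

isYes⁻ : ∀ {p} {P : Set p} {d : Dec P} → isYes d ≡ true → P
isYes⁻ = toWitness ∘ Equivalence.from T-≡

isYes⁺ : ∀ {p} {P : Set p} {d : Dec P} → P → isYes d ≡ true
isYes⁺ = Equivalence.to T-≡ ∘ fromWitness

-- Counting

count : ∀ {a} {A : Set a} → (A → Bool) → List A → ℕ
count P xs = length (filterᵇ P xs)

module _ {a} {A : Set a} where

  counterexample⊎count-≤ : ∀ (P Q : A → Bool) xs →
    (∃ λ x → P x ≡ true × Q x ≡ false) ⊎ count P xs ≤ count Q xs
  counterexample⊎count-≤ P Q [] = inj₂ z≤n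
  counterexample⊎count-≤ P Q (x ∷ xs) with P x in Px | Q x in Qx
  ... | true  | false = inj₁ (x , Px , Qx)
  ... | true  | true  = Sum.map₂ s≤s (counterexample⊎count-≤ P Q xs)
  ... | false | true  = Sum.map₂ m≤n⇒m≤1+n (counterexample⊎count-≤ P Q xs)
  ... | false | false = counterexample⊎count-≤ P Q xs

  count-mono : ∀ {P Q : A → Bool} xs → (∀ x → P x ≡ true → Q x ≡ true) → count P xs ≤ count Q xs
  count-mono {P} {Q} xs P⇒Q with counterexample⊎count-≤ P Q xs
  ... | inj₁ (x , Px , Qx) with () ← trans (sym (P⇒Q x Px)) Qx
  ... | inj₂ P≤Q = P≤Q

  count-none : ∀ {P : A → Bool} xs → (∀ x → P x ≢ true) → count P xs ≡ 0
  count-none [] ¬P = refl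
  count-none {P} (x ∷ xs) ¬P with P x in Px
  ... | true  = contradiction Px (¬P x)
  ... | false = count-none xs ¬P

  count-cong : ∀ {P Q : A → Bool} xs → (∀ x → P x ≡ Q x) → count P xs ≡ count Q xs
  count-cong [] P≗Q = refl
  count-cong {P} {Q} (x ∷ xs) P≗Q with P x | Q x | P≗Q x
  ... | true  | true  | refl = cong suc (count-cong xs P≗Q)
  ... | false | false | refl = count-cong xs P≗Q

  count-partition : ∀ (P Q : A → Bool) xs →
    count P xs ≡ count (λ x → P x ∧ Q x) xs + count (λ x → P x ∧ not (Q x)) xs
  count-partition P Q [] = refl
  count-partition P Q (x ∷ xs) with P x | Q x
  ... | true  | true  = cong suc (count-partition P Q xs)
  ... | true  | false = trans (cong suc (count-partition P Q xs)) (sym (+-suc _ _))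
  ... | false | _     = count-partition P Q xs

  count-++ : ∀ (P : A → Bool) xs ys → count P (xs ++ ys) ≡ count P xs + count P ys
  count-++ P xs ys = trans (cong length (filter-++ _ xs ys)) (length-++ (filterᵇ P xs))

  count-map : ∀ {b} {B : Set b} (P : A → Bool) (f : B → A) xs →
    count P (map f xs) ≡ count (λ y → P (f y)) xs
  count-map P f [] = refl
  count-map P f (y ∷ ys) with P (f y)
  ... | true  = cong suc (count-map P f ys)
  ... | false = count-map P f ys

  count-cover-scaled : ∀ {b} {B : Set b} (P : A → Bool) (Q : B → A → Bool) xs ys (m c : ℕ) →
    (∀ x → P x ≡ true → Any (λ y → Q y x ≡ true) ys) →
    All (λ y → m * count (Q y) xs ≤ c) ys →
    m * count P xs ≤ length ys * c
  count-cover-scaled P Q xs [] m c covered [] =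
    ≤-reflexive (trans (cong (m *_) (count-none xs λ x Px → case covered x Px of λ ())) (*-zeroʳ m))
  count-cover-scaled P Q xs (y ∷ ys) m c covered (Qy≤c ∷ Qys≤c) = begin
    m * count P xs                           ≡⟨ cong (m *_) (count-partition P (Q y) xs) ⟩
    m * (count P∧Qy xs + count P∧¬Qy xs)     ≡⟨ *-distribˡ-+ m _ _ ⟩
    m * count P∧Qy xs + m * count P∧¬Qy xs   ≤⟨ +-mono-≤ (≤-trans (*-monoʳ-≤ m (count-mono xs λ _ → ∧-conicalʳ _ _)) Qy≤c)
                                                         (count-cover-scaled P∧¬Qy Q xs ys m c covered′ Qys≤c) ⟩
    c + length ys * c                        ∎
    where
    open ≤-Reasoning
    P∧Qy = λ x → P x ∧ Q y x
    P∧¬Qy = λ x → P x ∧ not (Q y x)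
    covered′ : ∀ x → P∧¬Qy x ≡ true → Any (λ y → Q y x ≡ true) ys
    covered′ x e with covered x (∧-conicalˡ _ _ e)
    ... | here Qyx with () ← trans (sym (cong not Qyx)) (∧-conicalʳ _ _ e)
    ... | there Qys = Qys

  count-cover : ∀ {b} {B : Set b} (P : A → Bool) (Q : B → A → Bool) xs ys c →
    (∀ x → P x ≡ true → Any (λ y → Q y x ≡ true) ys) →
    All (λ y → count (Q y) xs ≤ c) ys →
    count P xs ≤ length ys * c
  count-cover P Q xs ys c covered bounded = subst (_≤ length ys * c) (*-identityˡ _)
    (count-cover-scaled P Q xs ys 1 c covered (All.map (subst (_≤ c) (sym (*-identityˡ _))) bounded))

allSubsets-complete : ∀ {n} (A : Subset n) → A ∈ₗ allSubsets n
allSubsets-complete []                     = here refl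
allSubsets-complete {suc n} (inside ∷ A)  = ∈-++⁺ˡ (∈-map⁺ (inside ∷_) (allSubsets-complete A))
allSubsets-complete {suc n} (outside ∷ A) =
  ∈-++⁺ʳ (map (inside ∷_) (allSubsets n)) (∈-map⁺ (outside ∷_) (allSubsets-complete A))

count-allSubsets-suc : ∀ {n} (P : Subset (suc n) → Bool) →
  count P (allSubsets (suc n)) ≡
  count (λ A → P (inside ∷ A)) (allSubsets n) + count (λ A → P (outside ∷ A)) (allSubsets n)
count-allSubsets-suc {n} P = trans (count-++ P (map (inside ∷_) (allSubsets n)) _)
  (cong₂ _+_ (count-map P (inside ∷_) (allSubsets n)) (count-map P (outside ∷_) (allSubsets n)))

elements : ∀ {n} → Subset n → List (Fin n)
elements []            = []
elements (inside ∷ p)  = zero ∷ map suc (elements p)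
elements (outside ∷ p) = map suc (elements p)

length-elements : ∀ {n} (p : Subset n) → length (elements p) ≡ ∣ p ∣
length-elements []            = refl
length-elements (inside ∷ p)  = cong suc (trans (length-map suc (elements p)) (length-elements p))
length-elements (outside ∷ p) = trans (length-map suc (elements p)) (length-elements p)

∈-elements⁺ : ∀ {n x} (p : Subset n) → x ∈ p → x ∈ₗ elements p
∈-elements⁺ (inside ∷ p)  here        = here refl
∈-elements⁺ (inside ∷ p)  (there x∈p) = there (∈-map⁺ suc (∈-elements⁺ p x∈p))
∈-elements⁺ (outside ∷ p) (there x∈p) = ∈-map⁺ suc (∈-elements⁺ p x∈p)

∈-elements⁻ : ∀ {n x} (p : Subset n) → x ∈ₗ elements p → x ∈ p
∈-elements⁻ (inside ∷ p) (here refl) = here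
∈-elements⁻ (inside ∷ p) (there x∈) with ∈-map⁻ suc x∈
... | _ , y∈ , refl = there (∈-elements⁻ p y∈)
∈-elements⁻ (outside ∷ p) x∈ with ∈-map⁻ suc x∈
... | _ , y∈ , refl = there (∈-elements⁻ p y∈)

∣p∪⁅x⁆∣≡1+∣p∣ : ∀ {n x} (p : Subset n) → x ∉ p → ∣ p ∪ ⁅ x ⁆ ∣ ≡ suc ∣ p ∣
∣p∪⁅x⁆∣≡1+∣p∣ {x = zero}  (inside ∷ p)  x∉p = contradiction here x∉p
∣p∪⁅x⁆∣≡1+∣p∣ {x = zero}  (outside ∷ p) x∉p = cong (suc ∘ ∣_∣) (∪-identityʳ p)
∣p∪⁅x⁆∣≡1+∣p∣ {x = suc x} (inside ∷ p)  x∉p = cong suc (∣p∪⁅x⁆∣≡1+∣p∣ p (x∉p ∘ there))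
∣p∪⁅x⁆∣≡1+∣p∣ {x = suc x} (outside ∷ p) x∉p = ∣p∪⁅x⁆∣≡1+∣p∣ p (x∉p ∘ there)

∣⁅x⁆∪⁅y⁆∣≡2 : ∀ {n} {x y : Fin n} → y ≢ x → ∣ ⁅ x ⁆ ∪ ⁅ y ⁆ ∣ ≡ 2
∣⁅x⁆∪⁅y⁆∣≡2 {x = x} y≢x = trans (∣p∪⁅x⁆∣≡1+∣p∣ ⁅ x ⁆ (x≢y⇒x∉⁅y⁆ y≢x)) (cong suc (∣⁅x⁆∣≡1 x))

⁅x⁆⊆⇒∈ : ∀ {n} {x : Fin n} {A} → ⁅ x ⁆ ⊆ A → x ∈ A
⁅x⁆⊆⇒∈ {x = x} ⁅x⁆⊆A = ⁅x⁆⊆A (x∈⁅x⁆ x)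

∈⇒⁅x⁆⊆ : ∀ {n} {x : Fin n} {A} → x ∈ A → ⁅ x ⁆ ⊆ A
∈⇒⁅x⁆⊆ {x = x} {A} x∈A y∈⁅x⁆ = subst (_∈ A) (sym (x∈⁅y⁆⇒x≡y x y∈⁅x⁆)) x∈A

∪⁅y⁆⊆ : ∀ {n} {X A : Subset n} {y} → X ⊆ A → y ∈ A → X ∪ ⁅ y ⁆ ⊆ A
∪⁅y⁆⊆ {X = X} {y = y} X⊆A y∈A z∈ = [ X⊆A , ∈⇒⁅x⁆⊆ y∈A ] (x∈p∪q⁻ X ⁅ y ⁆ z∈)

-- Degrees in uniform families

-- Chosen so that deg G X is, by definition, count (through G X) (allSubsets n).
through : ∀ {n} → Family n → Subset n → Family n
through G X A = G A ∧ isYes (X ⊆? A)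

module _ {n} (G : Family n) (X : Subset n) {A : Subset n} where

  ∈-through⁺ : A ∈F G → X ⊆ A → A ∈F through G X
  ∈-through⁺ A∈G X⊆A = cong₂ _∧_ A∈G (isYes⁺ X⊆A)

  ∈-through⁻ : A ∈F through G X → A ∈F G × X ⊆ A
  ∈-through⁻ e = ∧-conicalˡ (G A) _ e , isYes⁻ (∧-conicalʳ (G A) _ e)

Layer : ∀ {n} → ℕ → Family n
Layer m A = ∣ A ∣ ≡ᵇ m

Layer-uniform : ∀ {n} m → Uniform {n} m (Layer m)
Layer-uniform m A A∈ = ≡ᵇ⇒≡ _ _ (Equivalence.from T-≡ A∈)

-- isYes, unlike does, does not compute through the Dec.map in the definition of _⊆?_.
⊆?-inside : ∀ {n} (X A : Subset n) → isYes ((inside ∷ X) ⊆? (inside ∷ A)) ≡ isYes (X ⊆? A)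
⊆?-inside X A = trans (isYes≗does ((inside ∷ X) ⊆? (inside ∷ A))) (sym (isYes≗does (X ⊆? A)))

⊆?-outside : ∀ {n} b (X A : Subset n) → isYes ((outside ∷ X) ⊆? (b ∷ A)) ≡ isYes (X ⊆? A)
⊆?-outside b X A = trans (isYes≗does ((outside ∷ X) ⊆? (b ∷ A))) (sym (isYes≗does (X ⊆? A)))

deg-inside : ∀ {n} (G : Family (suc n)) X → deg G (inside ∷ X) ≡ deg (λ A → G (inside ∷ A)) X
deg-inside {n} G X = begin
  deg G (inside ∷ X)
    ≡⟨ count-allSubsets-suc (through G (inside ∷ X)) ⟩
  count (λ A → G (inside ∷ A) ∧ isYes ((inside ∷ X) ⊆? (inside ∷ A))) (allSubsets n)
    + count (λ A → G (outside ∷ A) ∧ false) (allSubsets n)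
    ≡⟨ cong₂ _+_ (count-cong (allSubsets n) λ A → cong (G (inside ∷ A) ∧_) (⊆?-inside X A))
                 (count-none (allSubsets n) λ A e → case trans (sym (∧-zeroʳ _)) e of λ ()) ⟩
  deg (λ A → G (inside ∷ A)) X + 0
    ≡⟨ +-identityʳ _ ⟩
  deg (λ A → G (inside ∷ A)) X ∎
  where open ≡-Reasoning

deg-outside : ∀ {n} (G : Family (suc n)) X →
  deg G (outside ∷ X) ≡ deg (λ A → G (inside ∷ A)) X + deg (λ A → G (outside ∷ A)) X
deg-outside {n} G X = trans (count-allSubsets-suc (through G (outside ∷ X)))
  (cong₂ _+_ (count-cong (allSubsets n) λ A → cong (G (inside ∷ A) ∧_) (⊆?-outside inside X A))
             (count-cong (allSubsets n) λ A → cong (G (outside ∷ A) ∧_) (⊆?-outside outside X A)))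

deg-uniform-small : ∀ {n m} {G : Family n} {X} → Uniform m G → m < ∣ X ∣ → deg G X ≡ 0
deg-uniform-small {n} {G = G} {X} uniform m<∣X∣ = count-none (allSubsets n) λ A A∈ →
  let A∈G , X⊆A = ∈-through⁻ G X A∈ in
  <⇒≱ m<∣X∣ (≤-trans (p⊆q⇒∣p∣≤∣q∣ X⊆A) (≤-reflexive (uniform A A∈G)))

deg-Layer-outside-zero : ∀ {n} (X : Subset n) → deg (Layer (∣ X ∣ + 0)) (outside ∷ X) ≡ deg (Layer (∣ X ∣ + 0)) X
deg-Layer-outside-zero X = trans (deg-outside (Layer _) X)
  (cong (_+ deg (Layer (∣ X ∣ + 0)) X) (trans (sym (deg-inside (Layer _) X))
    (deg-uniform-small {X = inside ∷ X} (Layer-uniform (∣ X ∣ + 0)) (s≤s (≤-reflexive (+-identityʳ _))))))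

deg-Layer-outside-suc : ∀ {n} (X : Subset n) j →
  deg (Layer (∣ X ∣ + suc j)) (outside ∷ X) ≡ deg (Layer (∣ X ∣ + j)) X + deg (Layer (∣ X ∣ + suc j)) X
deg-Layer-outside-suc X j = trans (deg-outside (Layer _) X)
  (cong (λ m → deg (λ A → Layer m (inside ∷ A)) X + deg (Layer (∣ X ∣ + suc j)) X) (+-suc ∣ X ∣ j))

binomial-lower-bound : ∀ j n → suc j * n ^ j + n ^ suc j ≤ suc n ^ suc j
binomial-lower-bound zero n = ≤-reflexive (expand n)
  where
  expand : ∀ n → 1 * 1 + n * 1 ≡ suc n * 1
  expand = solve-∀
binomial-lower-bound (suc j) n = begin
  suc (suc j) * (n * nʲ) + n * (n * nʲ)                 ≤⟨ m≤n+m _ (suc j * nʲ) ⟩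
  suc j * nʲ + (suc (suc j) * (n * nʲ) + n * (n * nʲ)) ≡⟨ expand j n nʲ ⟩
  suc n * (suc j * nʲ + n * nʲ)                         ≤⟨ *-monoʳ-≤ (suc n) (binomial-lower-bound j n) ⟩
  suc n * suc n ^ suc j                                 ∎
  where
  open ≤-Reasoning
  nʲ = n ^ j
  expand : ∀ j n a → suc j * a + (suc (suc j) * (n * a) + n * (n * a)) ≡ suc n * (suc j * a + n * a)
  expand = solve-∀

-- The left-hand side is j! (n - ∣X∣ choose j), bounded via Pascal's rule on the first point.
Layer-deg-bound : ∀ n (X : Subset n) j → j ! * deg (Layer (∣ X ∣ + j)) X ≤ n ^ j
Layer-deg-bound zero    []            zero    = ≤-refl
Layer-deg-bound zero    []            (suc j) = ≤-reflexive (*-zeroʳ (suc j !))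
Layer-deg-bound (suc n) (inside ∷ X)  j       = begin
  j ! * deg (Layer (suc ∣ X ∣ + j)) (inside ∷ X) ≡⟨ cong (j ! *_) (deg-inside (Layer _) X) ⟩
  j ! * deg (Layer (∣ X ∣ + j)) X                ≤⟨ Layer-deg-bound n X j ⟩
  n ^ j                                          ≤⟨ ^-monoˡ-≤ j (n≤1+n n) ⟩
  suc n ^ j                                      ∎
  where open ≤-Reasoning
Layer-deg-bound (suc n) (outside ∷ X) zero    =
  subst (λ d → 1 * d ≤ 1) (sym (deg-Layer-outside-zero X)) (Layer-deg-bound n X 0)
Layer-deg-bound (suc n) (outside ∷ X) (suc j) = begin
  suc j ! * deg (Layer (∣ X ∣ + suc j)) (outside ∷ X) ≡⟨ cong (suc j ! *_) (deg-Layer-outside-suc X j) ⟩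
  suc j ! * (d₀ + d₁)                                 ≡⟨ *-distribˡ-+ (suc j !) d₀ d₁ ⟩
  suc j ! * d₀ + suc j ! * d₁                         ≡⟨ cong (_+ suc j ! * d₁) (*-assoc (suc j) (j !) d₀) ⟩
  suc j * (j ! * d₀) + suc j ! * d₁                   ≤⟨ +-mono-≤ (*-monoʳ-≤ (suc j) (Layer-deg-bound n X j))
                                                                  (Layer-deg-bound n X (suc j)) ⟩
  suc j * n ^ j + n ^ suc j                           ≤⟨ binomial-lower-bound j n ⟩
  suc n ^ suc j                                       ∎
  where
  open ≤-Reasoning
  d₀ = deg (Layer (∣ X ∣ + j)) X
  d₁ = deg (Layer (∣ X ∣ + suc j)) X

deg-uniform-bound : ∀ {n} {G : Family n} X j → Uniform (∣ X ∣ + j) G → j ! * deg G X ≤ n ^ j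
deg-uniform-bound {n} {G} X j uniform = ≤-trans
  (*-monoʳ-≤ (j !) (count-mono (allSubsets n) λ A A∈ →
    cong₂ _∧_ (Equivalence.to T-≡ (≡⇒≡ᵇ _ _ (uniform A (∧-conicalˡ (G A) _ A∈)))) (∧-conicalʳ (G A) _ A∈)))
  (Layer-deg-bound n X j)

deg-vertex-bound : ∀ {n e} {G : Family n} x → Uniform (suc e) G → e ! * deg G ⁅ x ⁆ ≤ n ^ e
deg-vertex-bound {e = e} {G} x uniform =
  deg-uniform-bound ⁅ x ⁆ e (subst (λ m → Uniform (m + e) G) (sym (∣⁅x⁆∣≡1 x)) uniform)

-- At most (n choose e-1) ≤ n^(e-1) sets of size e+1 contain two given points, and none if e = 0.
pairBound : ℕ → ℕ → ℕ
pairBound zero    n = 0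
pairBound (suc e) n = n ^ e

deg-pair-bound : ∀ {n e} {G : Family n} {x y} → Uniform (suc e) G → y ≢ x → deg G (⁅ x ⁆ ∪ ⁅ y ⁆) ≤ pairBound e n
deg-pair-bound {e = zero} uniform y≢x =
  ≤-reflexive (deg-uniform-small uniform (≤-reflexive (sym (∣⁅x⁆∪⁅y⁆∣≡2 y≢x))))
deg-pair-bound {e = suc e} {G} {x} {y} uniform y≢x = ≤-trans (m≤n*m _ (e !) {{e !≢0}})
  (deg-uniform-bound (⁅ x ⁆ ∪ ⁅ y ⁆) e (subst (λ m → Uniform (m + e) G) (sym (∣⁅x⁆∪⁅y⁆∣≡2 y≢x)) uniform))

pairBound-dominated : ∀ {n} e m → n ^ e ≤ m * pairBound e n → n ≤ m
pairBound-dominated {n}     zero    m nᵉ≤ = contradiction (≤-trans nᵉ≤ (≤-reflexive (*-zeroʳ m))) λ ()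
pairBound-dominated {zero}  (suc e) m _   = z≤n
pairBound-dominated {suc n} (suc e) m nᵉ≤ = *-cancelʳ-≤ (suc n) m (suc n ^ e) {{m^n≢0 (suc n) e}} nᵉ≤

deg-extension-bound : ∀ {n m} {G : Family n} {A y} → Uniform (suc m) G → ∣ A ∣ ≡ m → y ∉ A →
  deg G (A ∪ ⁅ y ⁆) ≤ 1
deg-extension-bound {m = m} {G} {A} {y} uniform ∣A∣≡m y∉A = subst (_≤ 1) (*-identityˡ _)
  (deg-uniform-bound (A ∪ ⁅ y ⁆) 0
    (subst (λ l → Uniform l G) (sym ∣A∪⁅y⁆∣+0≡1+m) uniform))
  where
  ∣A∪⁅y⁆∣+0≡1+m : ∣ A ∪ ⁅ y ⁆ ∣ + 0 ≡ suc m
  ∣A∪⁅y⁆∣+0≡1+m = trans (+-identityʳ _) (trans (∣p∪⁅x⁆∣≡1+∣p∣ A y∉A) (cong suc ∣A∣≡m))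

KFam-uniform : ∀ {n} k d (H : Family n) → Uniform (k ∸ 1) (KFam k d H)
KFam-uniform k d H A A∈K = ≡ᵇ⇒≡ _ _ (Equivalence.from T-≡ (∧-conicalˡ _ _ A∈K))

KFam-deg : ∀ {n} k d (H : Family n) {A} → A ∈F KFam k d H → d ≤ deg H A
KFam-deg k d H A∈K = ≤ᵇ⇒≤ _ _ (Equivalence.from T-≡ (∧-conicalʳ _ _ A∈K))

-- Matchings

Avoids : ∀ {n} → Subset n → List (Fin n) → Set
Avoids A S = All (_∉ A) S

meets : ∀ {n} → List (Fin n) → Family n
meets S A = isYes (any? (_∈? A) S)

meets⁻ : ∀ {n} {S : List (Fin n)} {A} → A ∈F meets S → Any (_∈ A) S
meets⁻ = isYes⁻

¬meets⇒Avoids : ∀ {n} {S : List (Fin n)} {A} → meets S A ≡ false → Avoids A S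
¬meets⇒Avoids {S = S} e = All.¬Any⇒All¬ S λ any → case trans (sym (isYes⁺ any)) e of λ ()

member-avoiding : ∀ {n} (G : Family n) X S c →
  All (λ y → deg G (X ∪ ⁅ y ⁆) ≤ c) S → length S * c < deg G X →
  ∃ λ A → A ∈F G × X ⊆ A × Avoids A S
member-avoiding {n} G X S c bounded many
  with counterexample⊎count-≤ (through G X) (λ A → through G X A ∧ meets S A) (allSubsets n)
... | inj₁ (A , A∈ , A∉) = let A∈G , X⊆A = ∈-through⁻ G X A∈ in
  A , A∈G , X⊆A , ¬meets⇒Avoids (trans (cong (_∧ meets S A) (sym A∈)) A∉)
... | inj₂ few = contradiction
  (≤-trans few (count-cover _ (λ y → through G (X ∪ ⁅ y ⁆)) (allSubsets n) S c covered bounded)) (<⇒≱ many)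
  where
  covered : ∀ A → through G X A ∧ meets S A ≡ true → Any (λ y → through G (X ∪ ⁅ y ⁆) A ≡ true) S
  covered A e = let A∈G , X⊆A = ∈-through⁻ G X (∧-conicalˡ (through G X A) _ e) in
    Any.map (λ y∈A → ∈-through⁺ G _ A∈G (∪⁅y⁆⊆ X⊆A y∈A)) (meets⁻ (∧-conicalʳ (through G X A) _ e))

Avoidable : ∀ {n} → Family n → ℕ → Fin n → Set
Avoidable G b x = ∀ S → All (_≢ x) S → length S ≤ b → ∃ λ A → A ∈F G × x ∈ A × Avoids A S

Disjoint : ∀ {n} → Subset n → Subset n → Set
Disjoint A B = Empty (A ∩ B)

Disjoint-sym : ∀ {n} → Symmetric (Disjoint {n})
Disjoint-sym {x = A} {B} A∩B-empty (y , y∈) = A∩B-empty (y , subst (y ∈_) (∩-comm B A) y∈)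

IsMatchingList : ∀ {n} → Family n → List (Subset n) → Set
IsMatchingList G Es = All (_∈F G) Es × AllPairs Disjoint Es

vertices : ∀ {n} → List (Subset n) → List (Fin n)
vertices = concatMap elements

Avoids⇒Disjoint : ∀ {n} {A B : Subset n} → Avoids A (elements B) → Disjoint A B
Avoids⇒Disjoint {A = A} {B} avoids (y , y∈A∩B) =
  let y∈A , y∈B = x∈p∩q⁻ A B y∈A∩B in All.lookup avoids (∈-elements⁺ B y∈B) y∈A

Avoids-vertices⇒Disjoint : ∀ {n} {A : Subset n} {Es} → Avoids A (vertices Es) → All (Disjoint A) Es
Avoids-vertices⇒Disjoint = All.map Avoids⇒Disjoint ∘ All.map⁻ ∘ All.concat⁻

∉⇒elements≢ : ∀ {n} {x : Fin n} {E} → x ∉ E → All (_≢ x) (elements E)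
∉⇒elements≢ {E = E} x∉E = All.tabulate λ { y∈ refl → x∉E (∈-elements⁻ E y∈) }

∉⇒vertices≢ : ∀ {n} {x : Fin n} {Es} → All (x ∉_) Es → All (_≢ x) (vertices Es)
∉⇒vertices≢ = All.concat⁺ ∘ All.map⁺ ∘ All.map ∉⇒elements≢

length-vertices : ∀ {n r} {Es : List (Subset n)} → All (λ E → ∣ E ∣ ≤ r) Es →
  length (vertices Es) ≤ r * length Es
length-vertices []                                = z≤n
length-vertices {r = r} {E ∷ Es} (|E|≤r ∷ |Es|≤r) = begin
  length (elements E ++ vertices Es)         ≡⟨ length-++ (elements E) ⟩
  length (elements E) + length (vertices Es) ≤⟨ +-mono-≤ (≤-trans (≤-reflexive (length-elements E)) |E|≤r)
                                                         (length-vertices |Es|≤r) ⟩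
  r + r * length Es                          ≡⟨ *-suc r (length Es) ⟨
  r * suc (length Es)                        ∎
  where open ≤-Reasoning

AllPairs-lookup : ∀ {a r} {A : Set a} {R : A → A → Set r} → Symmetric R →
  ∀ {xs} → AllPairs R xs → ∀ {i j} → i ≢ j → R (lookup xs i) (lookup xs j)
AllPairs-lookup sym′ (Rx ∷ Rxs) {zero}  {zero}  i≢j = contradiction refl i≢j
AllPairs-lookup sym′ (Rx ∷ Rxs) {zero}  {suc j} i≢j = All.lookup Rx (∈-lookup j)
AllPairs-lookup sym′ (Rx ∷ Rxs) {suc i} {zero}  i≢j = sym′ (All.lookup Rx (∈-lookup i))
AllPairs-lookup sym′ (Rx ∷ Rxs) {suc i} {suc j} i≢j = AllPairs-lookup sym′ Rxs (i≢j ∘ cong suc)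

IsMatchingList⇒length≤ : ∀ {n} {G : Family n} {s Es} → ν≤ G s → IsMatchingList G Es → length Es ≤ s
IsMatchingList⇒length≤ {Es = Es} ν (Es∈G , disjoint) =
  ν (length Es) (lookup Es) ((λ i → All.lookup Es∈G (∈-lookup i)) , λ i j → AllPairs-lookup Disjoint-sym disjoint)

ν≤-mono : ∀ {n} {G G′ : Family n} {s} → (∀ A → A ∈F G′ → A ∈F G) → ν≤ G s → ν≤ G′ s
ν≤-mono G′⊆G ν m M (M∈G′ , disjoint) = ν m M ((λ i → G′⊆G (M i) (M∈G′ i)) , disjoint)

module _ {n} (G : Family n) {r b : ℕ} (1≤r : 1 ≤ r) (bounded : ∀ A → A ∈F G → ∣ A ∣ ≤ r) where

  -- The set for the first vertex x is chosen last, avoiding Fb and the sets already chosen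
  -- for the later vertices, which in turn were made to avoid x.
  greedy-matching : ∀ xs Fb → AllPairs _≢_ xs → All (Avoidable G b) xs → All (λ x → All (_≢ x) Fb) xs →
    length Fb + r * length xs ≤ b + r →
    ∃ λ Es → length Es ≡ length xs × IsMatchingList G Es × All (λ E → Avoids E Fb) Es
  greedy-matching []       Fb _ _ _ _ = [] , refl , ([] , []) , []
  greedy-matching (x ∷ xs) Fb (x≢xs ∷ distinct) (x-avoidable ∷ avoidable) (x∉Fb ∷ xs∉Fb) budget =
    let Es , |Es|≡ , (Es∈G , Es-disjoint) , Es-avoid =
          greedy-matching xs (x ∷ Fb) distinct avoidable
            (All.zipWith (λ (x≢y , y∉Fb) → x≢y ∷ y∉Fb) (x≢xs , xs∉Fb)) budget′
        A , A∈G , _ , A-avoids =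
          x-avoidable (Fb ++ vertices Es) (All.++⁺ x∉Fb (∉⇒vertices≢ (All.map All.head Es-avoid)))
            (begin
              length (Fb ++ vertices Es)       ≡⟨ length-++ Fb ⟩
              length Fb + length (vertices Es) ≤⟨ +-monoʳ-≤ (length Fb)
                                                    (length-vertices (All.map (bounded _) Es∈G)) ⟩
              length Fb + r * length Es        ≡⟨ cong (λ m → length Fb + r * m) |Es|≡ ⟩
              length Fb + r * length xs        ≤⟨ budget-left ⟩
              b                                ∎)
    in A ∷ Es , cong suc |Es|≡ , (A∈G ∷ Es∈G , Avoids-vertices⇒Disjoint (All.++⁻ʳ Fb A-avoids) ∷ Es-disjoint)
     , All.++⁻ˡ Fb A-avoids ∷ All.map All.tail Es-avoid
    where
    open ≤-Reasoning
    budget-left : length Fb + r * length xs ≤ b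
    budget-left = +-cancelʳ-≤ r _ _ (subst (_≤ b + r) (shift r (length Fb) (length xs)) budget)
      where
      shift : ∀ r a m → a + r * suc m ≡ a + r * m + r
      shift = solve-∀
    budget′ : suc (length Fb) + r * length xs ≤ b + r
    budget′ = ≤-trans (s≤s budget-left) (≤-trans (≤-reflexive (+-comm 1 b)) (+-monoʳ-≤ b 1≤r))

-- A maximal matching, grown one member at a time; it cannot pass s members.
matching-cover : ∀ {n} {G : Family n} {s} → ν≤ G s →
  ∃ λ Ms → IsMatchingList G Ms × length Ms ≤ s × (∀ A → A ∈F G → Any (_∈ A) (vertices Ms))
matching-cover {n} {G} {s} ν = grow (suc s) [] ([] , []) refl
  where
  grow : ∀ fuel Ms → IsMatchingList G Ms → length Ms + fuel ≡ suc s →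
    ∃ λ Ms → IsMatchingList G Ms × length Ms ≤ s × (∀ A → A ∈F G → Any (_∈ A) (vertices Ms))
  grow zero Ms matching eq =
    contradiction (IsMatchingList⇒length≤ ν matching) (subst (_≰ s) (sym (trans (sym (+-identityʳ _)) eq)) 1+n≰n)
  grow (suc fuel) Ms (Ms∈G , Ms-disjoint) eq
    with any? (λ A → (G A Bool.≟ true) ×-dec All.all? (λ y → ¬? (y ∈? A)) (vertices Ms)) (allSubsets n)
  ... | yes extensible = let A , A∈G , A-avoids = Any.satisfied extensible in
    grow fuel (A ∷ Ms) (A∈G ∷ Ms∈G , Avoids-vertices⇒Disjoint A-avoids ∷ Ms-disjoint)
      (trans (sym (+-suc _ fuel)) eq)
  ... | no maximal = Ms , (Ms∈G , Ms-disjoint) , length≤ , covers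
    where
    length≤ : length Ms ≤ s
    length≤ = ≤-pred (subst (suc (length Ms) ≤_) eq
                (≤-trans (s≤s (m≤m+n _ fuel)) (≤-reflexive (sym (+-suc _ fuel)))))
    covers : ∀ A → A ∈F G → Any (_∈ A) (vertices Ms)
    covers A A∈G with any? (_∈? A) (vertices Ms)
    ... | yes meet  = meet
    ... | no avoids = contradiction (lose (allSubsets-complete A) (A∈G , All.¬Any⇒All¬ _ avoids)) maximal

union-of-stars : ∀ {n} (H : Family n) xs → AllPairs _≢_ xs →
  All (λ x → ∃ λ F → F ∈F H × x ∈ F) xs → (∀ F → F ∈F H → Any (_∈ F) xs) →
  UnionOfTrivial (length xs) H
union-of-stars H xs distinct nonempty covered = lookup xs , star , lookup-injective , trivial , union
  where
  star : Fin (length xs) → Family _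
  star i = through H ⁅ lookup xs i ⁆
  lookup-injective : ∀ i j → lookup xs i ≡ lookup xs j → i ≡ j
  lookup-injective i j eq with i Fin.≟ j
  ... | yes i≡j = i≡j
  ... | no i≢j  = contradiction eq (AllPairs-lookup ≢-sym distinct i≢j)
  trivial : ∀ i → TrivialIntersectingAt (star i) (lookup xs i)
  trivial i = let F , F∈H , x∈F = All.lookup nonempty (∈-lookup i) in
    (F , ∈-through⁺ H _ F∈H (∈⇒⁅x⁆⊆ x∈F)) , λ F F∈ → ⁅x⁆⊆⇒∈ (proj₂ (∈-through⁻ H _ F∈))
  union : ∀ F → (F ∈F H → ∃ λ i → F ∈F star i) × ((∃ λ i → F ∈F star i) → F ∈F H)
  union F = (λ F∈H → let x∈F = covered F F∈H in Any.index x∈F , ∈-through⁺ H _ F∈H (∈⇒⁅x⁆⊆ (lookup-index x∈F)))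
          , λ (i , F∈) → proj₁ (∈-through⁻ H _ F∈)

-- Heavy vertices

module HeavyVertices {n} (e s : ℕ) (H : Family n) (H-uniform : Uniform (2 + e) H)
  (νH : ν≤ H s) (νK : ν≤ (KFam (2 + e) (s * (2 + e) + 1) H) s) where

  k : ℕ
  k = 2 + e

  K : Family n
  K = KFam k (s * k + 1) H

  K-uniform : Uniform (suc e) K
  K-uniform = KFam-uniform k (s * k + 1) H

  -- Above this K-degree a vertex lies in a member of K avoiding any s k other vertices.
  threshold : ℕ
  threshold = (s * k + 1) * pairBound e n

  Heavy : Fin n → Set
  Heavy x = threshold < deg K ⁅ x ⁆

  heavies : List (Fin n)
  heavies = filter (λ x → threshold <? deg K ⁅ x ⁆) (allFin n)

  heavies-distinct : AllPairs _≢_ heavies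
  heavies-distinct = AllPairs.filter⁺ _ (allFin⁺ n)

  heavies-heavy : All Heavy heavies
  heavies-heavy = All.all-filter _ (allFin n)

  heavy⇒Avoidable-K : ∀ {x} → Heavy x → Avoidable K (s * k) x
  heavy⇒Avoidable-K {x} heavy S S≢x |S|≤sk =
    let A , A∈K , ⁅x⁆⊆A , A-avoids = member-avoiding K ⁅ x ⁆ S (pairBound e n)
          (All.map (deg-pair-bound K-uniform) S≢x)
          (≤-<-trans (*-monoˡ-≤ (pairBound e n) (≤-trans |S|≤sk (m≤m+n (s * k) 1))) heavy)
    in A , A∈K , ⁅x⁆⊆⇒∈ ⁅x⁆⊆A , A-avoids

  heavy⇒Avoidable-H : ∀ {x} → Heavy x → Avoidable H (s * k) x
  heavy⇒Avoidable-H heavy S S≢x |S|≤sk =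
    let A , A∈K , x∈A , A-avoids = heavy⇒Avoidable-K heavy S S≢x |S|≤sk
        E , E∈H , A⊆E , E-avoids = member-avoiding H A S 1
          (All.map (deg-extension-bound H-uniform (K-uniform A A∈K)) A-avoids)
          (begin-strict
            length S * 1 ≡⟨ *-identityʳ _ ⟩
            length S     ≤⟨ |S|≤sk ⟩
            s * k        <⟨ m<m+n (s * k) z<s ⟩
            s * k + 1    ≤⟨ KFam-deg k (s * k + 1) H A∈K ⟩
            deg H A      ∎)
    in E , E∈H , A⊆E x∈A , E-avoids
    where open ≤-Reasoning

  heavy-edge : ∀ {x} → Heavy x → ∃ λ F → F ∈F H × x ∈ F
  heavy-edge heavy = let F , F∈H , x∈F , _ = heavy⇒Avoidable-H heavy [] [] z≤n in F , F∈H , x∈F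

  few-heavies : length heavies ≤ s
  few-heavies with length heavies ≤? s
  ... | yes ≤s = ≤s
  ... | no ≰s =
    let Es , |Es|≡ , Es-matching , _ =
          greedy-matching K (s≤s z≤n) (λ A A∈K → ≤-reflexive (K-uniform A A∈K))
            xs [] (AllPairs.take⁺ (suc s) heavies-distinct)
            (All.map heavy⇒Avoidable-K (All.take⁺ (suc s) heavies-heavy)) (All.tabulate λ _ → []) budget
    in contradiction (subst (_≤ s) (trans |Es|≡ |xs|≡1+s) (IsMatchingList⇒length≤ νK Es-matching)) 1+n≰n
    where
    xs = take (suc s) heavies
    |xs|≡1+s : length xs ≡ suc s
    |xs|≡1+s = trans (length-take (suc s) heavies) (m≤n⇒m⊓n≡m (≰⇒> ≰s))
    budget : 0 + suc e * length xs ≤ s * k + suc e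
    budget = begin
      suc e * length xs ≡⟨ cong (suc e *_) |xs|≡1+s ⟩
      suc e * suc s     ≡⟨ trans (*-suc (suc e) s) (+-comm (suc e) _) ⟩
      suc e * s + suc e ≡⟨ cong (_+ suc e) (*-comm (suc e) s) ⟩
      s * suc e + suc e ≤⟨ +-monoˡ-≤ (suc e) (*-monoʳ-≤ s (n≤1+n (suc e))) ⟩
      s * k + suc e     ∎
      where open ≤-Reasoning

  heavies-cover : length heavies ≡ s → ∀ F → F ∈F H → Any (_∈ F) heavies
  heavies-cover |heavies|≡s F F∈H with any? (_∈? F) heavies
  ... | yes meet  = meet
  ... | no avoids =
    let Es , |Es|≡ , (Es∈H , Es-disjoint) , Es-avoid =
          greedy-matching H (s≤s z≤n) (λ A A∈H → ≤-reflexive (H-uniform A A∈H))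
            heavies (elements F) heavies-distinct (All.map heavy⇒Avoidable-H heavies-heavy)
            (All.map ∉⇒elements≢ (All.¬Any⇒All¬ heavies avoids)) budget
        F∷Es-matching = F∈H ∷ Es∈H , All.map (Disjoint-sym ∘ Avoids⇒Disjoint) Es-avoid ∷ Es-disjoint
    in contradiction (subst (_≤ s) (cong suc (trans |Es|≡ |heavies|≡s)) (IsMatchingList⇒length≤ νH F∷Es-matching))
         1+n≰n
    where
    budget : length (elements F) + k * length heavies ≤ s * k + k
    budget = ≤-reflexive (begin
      length (elements F) + k * length heavies
        ≡⟨ cong₂ (λ a b → a + k * b) (trans (length-elements F) (H-uniform F F∈H)) |heavies|≡s ⟩
      k + k * s
        ≡⟨ trans (+-comm k (k * s)) (cong (_+ k) (*-comm k s)) ⟩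
      s * k + k ∎)
      where open ≡-Reasoning

  K-heavy K-light : Family n
  K-heavy A = K A ∧ meets heavies A
  K-light A = K A ∧ not (meets heavies A)

  K-heavy-count : e ! * card K-heavy ≤ length heavies * n ^ e
  K-heavy-count = count-cover-scaled K-heavy (λ x → through K ⁅ x ⁆) (allSubsets n) heavies (e !) (n ^ e)
    (λ A A∈ → Any.map (λ x∈A → ∈-through⁺ K _ (∧-conicalˡ (K A) _ A∈) (∈⇒⁅x⁆⊆ x∈A))
                      (meets⁻ (∧-conicalʳ (K A) _ A∈)))
    (All.tabulate λ {x} _ → deg-vertex-bound x K-uniform)

  light : ∀ {M v} → Avoids M heavies → v ∈ M → deg K ⁅ v ⁆ ≤ threshold
  light M-avoids v∈M = ≮⇒≥ λ heavy → All.lookup M-avoids (∈-filter⁺ _ (∈-allFin _) heavy) v∈M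

  -- A maximal matching of K-light has at most (e+1)s vertices, none of them heavy.
  K-light-count : card K-light ≤ (suc e * s) * threshold
  K-light-count =
    let Ms , (Ms∈K-light , _) , |Ms|≤s , cover =
          matching-cover {G = K-light} (ν≤-mono (λ A → ∧-conicalˡ (K A) (not (meets heavies A))) νK)
        V-light = All.concat⁺ (All.map⁺ (All.map (λ {M} M∈ → All.tabulate λ v∈ →
                    light (¬meets⇒Avoids (not-injective (∧-conicalʳ (K M) _ M∈))) (∈-elements⁻ M v∈)) Ms∈K-light))
        |V|≤ = length-vertices (All.map (λ {M} M∈ → ≤-reflexive (K-uniform M (∧-conicalˡ (K M) _ M∈))) Ms∈K-light)
    in begin
      card K-light
        ≤⟨ count-cover K-light (λ v → through K ⁅ v ⁆) (allSubsets n) (vertices Ms) threshold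
             (λ A A∈ → Any.map (λ v∈A → ∈-through⁺ K _ (∧-conicalˡ (K A) _ A∈) (∈⇒⁅x⁆⊆ v∈A)) (cover A A∈))
             V-light ⟩
      length (vertices Ms) * threshold
        ≤⟨ *-monoˡ-≤ threshold (≤-trans |V|≤ (*-monoʳ-≤ (suc e) |Ms|≤s)) ⟩
      (suc e * s) * threshold ∎
    where open ≤-Reasoning

  K-count-bound : e ! * card K ≤ length heavies * n ^ e + e ! * ((suc e * s) * threshold)
  K-count-bound = begin
    e ! * card K                             ≡⟨ cong (e ! *_) (count-partition K (meets heavies) (allSubsets n)) ⟩
    e ! * (card K-heavy + card K-light)      ≡⟨ *-distribˡ-+ (e !) _ _ ⟩
    e ! * card K-heavy + e ! * card K-light  ≤⟨ +-mono-≤ K-heavy-count (*-monoʳ-≤ (e !) K-light-count) ⟩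
    length heavies * n ^ e + e ! * ((suc e * s) * threshold) ∎
    where open ≤-Reasoning

  few-heavies⇒n≤ : ∀ B → length heavies ≤ s ∸ 1 →
    B * (s ∸ 1) * n ^ e + e ! * n ^ e ≤ B * (e ! * card K) →
    n ≤ B * ((suc e * s) * (s * k + 1))
  few-heavies⇒n≤ B few dense =
    pairBound-dominated e _ (*-cancelˡ-≤ (e !) {{e !≢0}} (+-cancelˡ-≤ (B * (s ∸ 1) * n ^ e) _ _ (begin
      B * (s ∸ 1) * n ^ e + e ! * n ^ e
        ≤⟨ dense ⟩
      B * (e ! * card K)
        ≤⟨ *-monoʳ-≤ B (≤-trans K-count-bound (+-monoˡ-≤ _ (*-monoˡ-≤ (n ^ e) few))) ⟩
      B * ((s ∸ 1) * n ^ e + e ! * ((suc e * s) * ((s * k + 1) * pairBound e n)))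
        ≡⟨ regroup B (s ∸ 1) (n ^ e) (e !) (suc e * s) (s * k + 1) (pairBound e n) ⟩
      B * (s ∸ 1) * n ^ e + e ! * (B * ((suc e * s) * (s * k + 1)) * pairBound e n) ∎)))
    where
    open ≤-Reasoning
    regroup : ∀ B a m f x y p → B * (a * m + f * (x * (y * p))) ≡ B * a * m + f * (B * (x * y) * p)
    regroup = solve-∀

  dense⇒UnionOfTrivial : ∀ B → B * (s ∸ 1) * n ^ e + e ! * n ^ e ≤ B * (e ! * card K) →
    B * ((suc e * s) * (s * k + 1)) < n → UnionOfTrivial s H
  dense⇒UnionOfTrivial B dense large with length heavies ≟ s
  ... | yes |heavies|≡s = subst (λ m → UnionOfTrivial m H) |heavies|≡s
    (union-of-stars H heavies heavies-distinct (All.map heavy-edge heavies-heavy) (heavies-cover |heavies|≡s))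
  ... | no |heavies|≢s =
    contradiction (few-heavies⇒n≤ B (∸-monoˡ-≤ 1 (≤∧≢⇒< few-heavies |heavies|≢s)) dense) (<⇒≱ large)

-- Rational arithmetic

ℕ→ℚ≡mkℚ : ∀ a → ℕ→ℚ a ≡ mkℚ (+ a) 0 (coprime-sym (1-coprimeTo a))
ℕ→ℚ≡mkℚ a = ℚ.↥p/↧p≡p (mkℚ (+ a) 0 (coprime-sym (1-coprimeTo a)))

ℕ→ℚ-+ : ∀ a b → ℕ→ℚ (a + b) ≡ ℕ→ℚ a ℚ.+ ℕ→ℚ b
ℕ→ℚ-+ a b rewrite ℕ→ℚ≡mkℚ a | ℕ→ℚ≡mkℚ b =
  cong (_/ 1) (trans (ℤ.pos-+ a b) (sym (cong₂ ℤ._+_ (ℤ.*-identityʳ (+ a)) (ℤ.*-identityʳ (+ b)))))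

ℕ→ℚ-* : ∀ a b → ℕ→ℚ (a * b) ≡ ℕ→ℚ a ℚ.* ℕ→ℚ b
ℕ→ℚ-* a b rewrite ℕ→ℚ≡mkℚ a | ℕ→ℚ≡mkℚ b = cong (_/ 1) (ℤ.pos-* a b)

ℕ→ℚ-cancel-≤ : ∀ a b → ℕ→ℚ a ℚ.≤ ℕ→ℚ b → a ≤ b
ℕ→ℚ-cancel-≤ a b a≤b rewrite ℕ→ℚ≡mkℚ a | ℕ→ℚ≡mkℚ b with a≤b
... | ℚ.*≤* a*1≤b*1 = ℤ.drop‿+≤+ (subst₂ ℤ._≤_ (ℤ.*-identityʳ (+ a)) (ℤ.*-identityʳ (+ b)) a*1≤b*1)

ℕ→ℚ-*-nonNeg : ∀ a b → NonNegative (ℕ→ℚ a ℚ.* ℕ→ℚ b)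
ℕ→ℚ-*-nonNeg a b = subst NonNegative (trans (sym (ℕ→ℚ≡mkℚ (a * b))) (ℕ→ℚ-* a b)) _

/-*-cancel : ∀ a F .{{_ : NonZero F}} → (+ a / F) ℚ.* ℕ→ℚ F ≡ ℕ→ℚ a
/-*-cancel a (suc F) = ℚ.toℚᵘ-injective (begin
  ℚ.toℚᵘ ((+ a / suc F) ℚ.* ℕ→ℚ (suc F))        ≈⟨ ℚ.toℚᵘ-homo-* (+ a / suc F) (ℕ→ℚ (suc F)) ⟩
  ℚ.toℚᵘ (+ a / suc F) ℚᵘ.* ℚ.toℚᵘ (ℕ→ℚ (suc F)) ≈⟨ ℚᵘ.*-cong (ℚ.toℚᵘ-fromℚᵘ (mkℚᵘ (+ a) F))
                                                               (ℚ.toℚᵘ-fromℚᵘ (mkℚᵘ (+ suc F) 0)) ⟩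
  mkℚᵘ (+ a) F ℚᵘ.* mkℚᵘ (+ suc F) 0             ≈⟨ *≡* (trans (ℤ.*-identityʳ _)
                                                       (cong (λ m → + a ℤ.* + suc m) (sym (*-identityʳ F)))) ⟩
  mkℚᵘ (+ a) 0                                   ≈⟨ ℚ.toℚᵘ-fromℚᵘ (mkℚᵘ (+ a) 0) ⟨
  ℚ.toℚᵘ (ℕ→ℚ a)                                 ∎)
  where open ℚᵘ.≃-Reasoning

archimedean : ∀ p → Positive p → ∃ λ B → 1ℚ ℚ.≤ p ℚ.* ℕ→ℚ B
archimedean p@(mkℚ +[1+ a ] d _) _ = suc d , ℚ.toℚᵘ-cancel-≤ (begin
  ℚ.toℚᵘ 1ℚ                              ≤⟨ *≤* (+≤+ (s≤s d≤d+a[1+d])) ⟩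
  mkℚᵘ +[1+ a ] d ℚᵘ.* mkℚᵘ (+ suc d) 0  ≃⟨ ℚᵘ.*-cong ℚᵘ.≃-refl (ℚ.toℚᵘ-fromℚᵘ (mkℚᵘ (+ suc d) 0)) ⟨
  ℚ.toℚᵘ p ℚᵘ.* ℚ.toℚᵘ (ℕ→ℚ (suc d))     ≃⟨ ℚ.toℚᵘ-homo-* p (ℕ→ℚ (suc d)) ⟨
  ℚ.toℚᵘ (p ℚ.* ℕ→ℚ (suc d))             ∎)
  where
  open ℚᵘ.≤-Reasoning
  d≤d+a[1+d] : d * 1 + 0 ≤ (d + a * suc d) * 1
  d≤d+a[1+d] = ≤-trans (≤-reflexive (trans (+-identityʳ (d * 1)) (*-identityʳ d)))
                       (≤-trans (m≤m+n d (a * suc d)) (≤-reflexive (sym (*-identityʳ _))))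

open +-*-Solver

-∣p∣≤p : ∀ p → ℚ.- ℚ.∣ p ∣ ℚ.≤ p
-∣p∣≤p p with ℚ.∣p∣≡p∨∣p∣≡-p p
... | inj₁ ∣p∣≡p  = ℚ.≤-trans (ℚ.neg-antimono-≤ (ℚ.0≤∣p∣ p)) (ℚ.∣p∣≡p⇒0≤p ∣p∣≡p)
... | inj₂ ∣p∣≡-p = ℚ.≤-reflexive (trans (cong ℚ.-_ ∣p∣≡-p) (solve 1 (λ p → :- (:- p) := p) refl p))

absorb-error : ∀ c ε M K g → (c ℚ.+ ε) ℚ.* M ℚ.+ g ℚ.≤ K → ℚ.∣ g ∣ ℚ.≤ (ε ℚ.* ½) ℚ.* M →
  c ℚ.* M ℚ.+ (ε ℚ.* ½) ℚ.* M ℚ.≤ K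
absorb-error c ε M K g bound small = begin
  c ℚ.* M ℚ.+ (ε ℚ.* ½) ℚ.* M
    ≡⟨ solve 3 (λ c ε M → c :* M :+ (ε :* con ½) :* M := (c :+ ε) :* M :+ :- ((ε :* con ½) :* M)) refl c ε M ⟩
  (c ℚ.+ ε) ℚ.* M ℚ.+ ℚ.- ((ε ℚ.* ½) ℚ.* M)
    ≤⟨ ℚ.+-monoʳ-≤ ((c ℚ.+ ε) ℚ.* M) (ℚ.≤-trans (ℚ.neg-antimono-≤ small) (-∣p∣≤p g)) ⟩
  (c ℚ.+ ε) ℚ.* M ℚ.+ g
    ≤⟨ bound ⟩
  K ∎
  where open ℚ.≤-Reasoning

-- The error term is absorbed by half of ε, and the other half dominates 1/B.
scaled-lower-bound : ∀ a F .{{_ : NonZero F}} ε B M K g → 1ℚ ℚ.≤ (ε ℚ.* ½) ℚ.* ℕ→ℚ B →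
  ((+ a / F) ℚ.+ ε) ℚ.* ℕ→ℚ M ℚ.+ g ℚ.≤ ℕ→ℚ K → ℚ.∣ g ∣ ℚ.≤ (ε ℚ.* ½) ℚ.* ℕ→ℚ M →
  B * a * M + F * M ≤ B * (F * K)
scaled-lower-bound a F ε B M K g 1≤δB bound small = ℕ→ℚ-cancel-≤ _ _ (begin
  ℕ→ℚ (B * a * M + F * M)
    ≡⟨ trans (ℕ→ℚ-+ (B * a * M) (F * M))
         (cong₂ ℚ._+_ (trans (ℕ→ℚ-* (B * a) M) (cong (ℚ._* qM) (ℕ→ℚ-* B a))) (ℕ→ℚ-* F M)) ⟩
  qB ℚ.* ℕ→ℚ a ℚ.* qM ℚ.+ qF ℚ.* qM
    ≡⟨ cong₂ (λ x y → qB ℚ.* x ℚ.* qM ℚ.+ y) (sym (/-*-cancel a F)) (sym (ℚ.*-identityʳ (qF ℚ.* qM))) ⟩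
  qB ℚ.* (c ℚ.* qF) ℚ.* qM ℚ.+ qF ℚ.* qM ℚ.* 1ℚ
    ≤⟨ ℚ.+-monoʳ-≤ (qB ℚ.* (c ℚ.* qF) ℚ.* qM) (ℚ.*-monoˡ-≤-nonNeg (qF ℚ.* qM) {{ℕ→ℚ-*-nonNeg F M}} 1≤δB) ⟩
  qB ℚ.* (c ℚ.* qF) ℚ.* qM ℚ.+ qF ℚ.* qM ℚ.* (δ ℚ.* qB)
    ≡⟨ solve 5 (λ qB c qF qM δ → qB :* (c :* qF) :* qM :+ qF :* qM :* (δ :* qB)
                                := (qF :* qB) :* (c :* qM :+ δ :* qM)) refl qB c qF qM δ ⟩
  (qF ℚ.* qB) ℚ.* (c ℚ.* qM ℚ.+ δ ℚ.* qM)
    ≤⟨ ℚ.*-monoˡ-≤-nonNeg (qF ℚ.* qB) {{ℕ→ℚ-*-nonNeg F B}} (absorb-error c ε qM (ℕ→ℚ K) g bound small) ⟩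
  (qF ℚ.* qB) ℚ.* ℕ→ℚ K
    ≡⟨ solve 3 (λ qF qB qK → (qF :* qB) :* qK := qB :* (qF :* qK)) refl qF qB (ℕ→ℚ K) ⟩
  qB ℚ.* (qF ℚ.* ℕ→ℚ K)
    ≡⟨ sym (trans (ℕ→ℚ-* B (F * K)) (cong (qB ℚ.*_) (ℕ→ℚ-* F K))) ⟩
  ℕ→ℚ (B * (F * K)) ∎)
  where
  open ℚ.≤-Reasoning
  qB = ℕ→ℚ B
  qF = ℕ→ℚ F
  qM = ℕ→ℚ M
  c = + a / F
  δ = ε ℚ.* ½

lemma2p6 : (k s p : ℕ) → 1 ≤ s → 2 ≤ k → 2 ≤ p →
    (ε : ℚ) → ℚ.Positive ε →
    (H : (n : ℕ) → Family n) →
    (∀ n → Uniform k (H n)) →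
    (∀ n → ν≤ (H n) s) →
    (∀ n → ν≤ (KFam k (s * k + 1) (H n)) s) →
    (g : ℕ → ℚ) → IsLittleO (k ∸ 2) g →
    (∀ n → (const s k ℚ.+ ε) ℚ.* ℕ→ℚ (n ^ (k ∸ 2)) ℚ.+ g n
             ℚ.≤ ℕ→ℚ (card (KFam k (s * k + 1) (H n)))) →
    ∃ λ N → ∀ n → N ≤ n → UnionOfTrivial s (H n)
lemma2p6 (suc zero) _ _ _ (s≤s ()) _
lemma2p6 (suc (suc e)) s _ _ _ _ ε ε>0 H uniform νH νK g g=o[nᵉ] bound =
  let ε/2>0 = ℚ.pos*pos⇒pos ε {{ε>0}} ½
      B , 1≤εB/2 = archimedean (ε ℚ.* ½) ε/2>0
      N , g-small = g=o[nᵉ] (ε ℚ.* ½) ε/2>0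
  in N ⊔ suc (B * ((suc e * s) * (s * suc (suc e) + 1))) , λ n N≤n →
       HeavyVertices.dense⇒UnionOfTrivial e s (H n) (uniform n) (νH n) (νK n) B
         (scaled-lower-bound (s ∸ 1) (e !) {{e !≢0}} ε B _ _ (g n) 1≤εB/2 (bound n)
           (g-small n (m⊔n≤o⇒m≤o _ _ N≤n)))
         (m⊔n≤o⇒n≤o _ _ N≤n)
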